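{- Let $\Delta_2\in\mathbb Z^+$. If two $\Delta_2$-indivisible sets $S_1$ and $S_2$ of time-edges satisfy $S_1\cap S_2\ne\emptyset$, then $S_1\cup S_2$ is $\Delta_2$-indivisible.
   Context: A time-edge is a pair $(e,t)$ with $e$ an unordered pair of vertices and $t\in\mathbb Z^+$. An interval $[a,b]$ means $\{a,\dots,b\}\subseteq\mathbb Z$. For a set $S$ of time-edges, $V(S)$ is the set of endpoints of its time-edges and $L(S)=[\min\{t:(e,t)\in S\},\max\{t:(e,t)\in S\}]$; $S$ generates the template $(V(S),L(S))$. Templates $(X,[a,b])$, $(Y,[c,d])$ are $\Delta_2$-independent if $X\cap Y=\emptyset$ or $|s-t|\ge\Delta_2$ for all $s\in[a,b]$, $t\in[c,d]$; two sets of time-edges are $\Delta_2$-independent if the templates they generate are. A set $S$ of time-edges is $\Delta_2$-indivisible if it cannot be written as the union of at least two nonempty, pairwise $\Delta_2$-independent sets of time-edges. -}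

module Defs where

open import Level using (0ℓ)
open import Data.Nat using (ℕ; _<_; _≤_; ∣_-_∣)
open import Data.Fin using (Fin)
open import Data.List using (List)
open import Data.List.Membership.Propositional using (_∈_)
open import Data.Product using (_×_; ∃; Σ)
open import Data.Sum using (_⊎_)
open import Relation.Nullary using (¬_)
open import Relation.Binary.PropositionalEquality using (_≡_; _≢_)
open import Relation.Unary using (Pred; Satisfiable)

-- Vertices are natural numbers.  A time-edge ({u,v}, t) is stored canonically
-- with u < v (so the unordered pair {u,v} has a unique representation) and t ≥ 1.
record TimeEdge : Set where
  constructor te
  field
    u : ℕ
    v : ℕ
    t : ℕ
open TimeEdge public

WellFormed : TimeEdge → Set
WellFormed x = (u x < v x) × (1 ≤ t x)

TESet : Set₁
TESet = Pred TimeEdge 0ℓ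

WellFormedSet : TESet → Set
WellFormedSet S = ∀ x → S x → WellFormed x

Finite : TESet → Set
Finite S = ∃ λ (xs : List TimeEdge) → ∀ x → S x → x ∈ xs

InV : TESet → ℕ → Set
InV S w = ∃ λ x → S x × (w ≡ u x ⊎ w ≡ v x)

-- s ∈ L(S) = [min {t}, max {t}], i.e. some time-edges of S have times ≤ s and ≥ s.
InL : TESet → ℕ → Set
InL S s = ∃ λ x → ∃ λ y → S x × S y × (t x ≤ s) × (s ≤ t y)

Independent : ℕ → TESet → TESet → Set
Independent Δ₂ A B =
  (∀ w → ¬ (InV A w × InV B w))
  ⊎ (∀ s r → InL A s → InL B r → Δ₂ ≤ ∣ s - r ∣)

Divisible : ℕ → TESet → Set₁
Divisible Δ₂ S =
  Σ ℕ λ k → (2 ≤ k) × Σ (Fin k → TESet) λ A →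
      (∀ i → Satisfiable (A i))
    × (∀ i j → i ≢ j → Independent Δ₂ (A i) (A j))
    × (∀ x → (S x → ∃ λ i → A i x) × ((∃ λ i → A i x) → S x))

Indivisible : ℕ → TESet → Set₁
Indivisible Δ₂ S = ¬ Divisible Δ₂ S

-- Given a division of S₁ ∪ S₂ into pairwise independent parts, the shared
-- time-edge lies in some part and any other part contains a time-edge of S₁ or
-- of S₂; say of S₁. Then S₁ meets two distinct parts. Intersecting S₁ with the
-- parts it meets (subsets of independent sets stay independent) divides S₁,
-- contradicting its indivisibility. Which parts S₁ meets is not decidable, but
-- since the goal is ⊥ we may assume it by double negation.
module Submission where

open import Defs
open import Data.Nat as ℕ using (ℕ; _≤_; s≤s; z≤n)
open import Data.Fin using (Fin; zero; suc)
open import Data.List using (List; []; _∷_; length; lookup; filter; allFin)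
open import Data.List.Membership.Propositional using (_∈_)
open import Data.List.Membership.Propositional.Properties
  using (∈-filter⁺; ∈-filter⁻; ∈-lookup; ∈-allFin)
open import Data.List.Relation.Unary.Any using (here; index)
open import Data.List.Relation.Unary.Any.Properties using (lookup-index)
open import Data.List.Relation.Unary.All using () renaming (lookup to All-lookup)
open import Data.List.Relation.Unary.AllPairs using (_∷_)
open import Data.List.Relation.Unary.Unique.Propositional using (Unique)
open import Data.List.Relation.Unary.Unique.Propositional.Properties using (allFin⁺; filter⁺)
open import Data.Product using (_×_; _,_; ∃; proj₁; proj₂)
open import Data.Sum using (inj₁; inj₂)
open import Data.Empty using (⊥)
open import Function using (_∘_)
open import Relation.Nullary using (¬_; Dec)
open import Relation.Nullary.Negation using (contradiction)
open import Relation.Nullary.Decidable using (¬¬-excluded-middle)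
open import Relation.Binary.PropositionalEquality using (_≡_; _≢_; refl; sym; cong; subst)
open import Relation.Unary using (Satisfiable; Decidable; _∩_; _∪_; _⊆_)

InV-mono : ∀ {A B} → A ⊆ B → ∀ w → InV A w → InV B w
InV-mono A⊆B w (x , Ax , w∈x) = x , A⊆B Ax , w∈x

InL-mono : ∀ {A B} → A ⊆ B → ∀ s → InL A s → InL B s
InL-mono A⊆B s (x , y , Ax , Ay , x≤s , s≤y) = x , y , A⊆B Ax , A⊆B Ay , x≤s , s≤y

Independent-antimono : ∀ {Δ A B A′ B′} → A′ ⊆ A → B′ ⊆ B
                     → Independent Δ A B → Independent Δ A′ B′
Independent-antimono A′⊆A B′⊆B (inj₁ disjoint) =
  inj₁ λ w (w∈A′ , w∈B′) → disjoint w (InV-mono A′⊆A w w∈A′ , InV-mono B′⊆B w w∈B′)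
Independent-antimono A′⊆A B′⊆B (inj₂ separated) =
  inj₂ λ s r s∈A′ r∈B′ → separated s r (InL-mono A′⊆A s s∈A′) (InL-mono B′⊆B r r∈B′)

¬¬-decidable : ∀ k (P : Fin k → Set) → ¬ ¬ (∀ i → Dec (P i))
¬¬-decidable ℕ.zero    P ¬P? = ¬P? λ ()
¬¬-decidable (ℕ.suc k) P ¬P? = ¬¬-excluded-middle λ P₀? →
  ¬¬-decidable k (P ∘ suc) λ P₊? → ¬P? λ { zero → P₀? ; (suc i) → P₊? i }

lookup-injective : ∀ {X : Set} (xs : List X) → Unique xs
                 → ∀ m n → lookup xs m ≡ lookup xs n → m ≡ n
lookup-injective (_ ∷ _)  _           zero    zero    _  = refl
lookup-injective (_ ∷ _)  (x∉ ∷ _)    zero    (suc n) eq = contradiction eq (All-lookup x∉ (∈-lookup n))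
lookup-injective (_ ∷ _)  (x∉ ∷ _)    (suc m) zero    eq = contradiction (sym eq) (All-lookup x∉ (∈-lookup m))
lookup-injective (_ ∷ xs) (_ ∷ uniq) (suc m) (suc n) eq = cong suc (lookup-injective xs uniq m n eq)

2≤length : ∀ {X : Set} {x y : X} (xs : List X) → x ∈ xs → y ∈ xs → x ≢ y → 2 ≤ length xs
2≤length (_ ∷ [])    (here refl) (here refl) x≢y = contradiction refl x≢y
2≤length (_ ∷ _ ∷ _) _           _           _   = s≤s (s≤s z≤n)

∃-≢ : ∀ {k} → 2 ≤ k → (i : Fin k) → ∃ (i ≢_)
∃-≢ (s≤s (s≤s _)) zero    = suc zero , λ ()
∃-≢ (s≤s (s≤s _)) (suc i) = zero , λ ()

module _ {Δ k : ℕ} {A : Fin k → TESet}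
         (indep : ∀ i j → i ≢ j → Independent Δ (A i) (A j)) where

  Meets : TESet → Fin k → Set
  Meets S i = Satisfiable (S ∩ A i)

  restriction-divides : ∀ {S} → Decidable (Meets S) → (∀ x → S x → ∃ λ i → A i x)
                      → ∀ {i j} → i ≢ j → Meets S i → Meets S j → Divisible Δ S
  restriction-divides {S} meets? covered {i} {j} i≢j meetsᵢ meetsⱼ =
    length met , 2≤length met (∈met meetsᵢ) (∈met meetsⱼ) i≢j , B , nonempty , B-indep , covers
    where
    met : List (Fin k)
    met = filter meets? (allFin k)

    ∈met : ∀ {i} → Meets S i → i ∈ met
    ∈met = ∈-filter⁺ meets? (∈-allFin _)

    B : Fin (length met) → TESet
    B m = S ∩ A (lookup met m)

    nonempty : ∀ m → Satisfiable (B m)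
    nonempty m = proj₂ (∈-filter⁻ meets? {xs = allFin k} (∈-lookup m))

    B-indep : ∀ m n → m ≢ n → Independent Δ (B m) (B n)
    B-indep m n m≢n = Independent-antimono proj₂ proj₂
      (indep _ _ (m≢n ∘ lookup-injective met (filter⁺ meets? (allFin⁺ k)) m n))

    covers : ∀ x → (S x → ∃ λ m → B m x) × ((∃ λ m → B m x) → S x)
    covers x = into , λ (_ , Sx , _) → Sx
      where
      into : S x → ∃ λ m → B m x
      into Sx with covered x Sx
      ... | i , Aᵢx = index i∈ , Sx , subst (λ i → A i x) (lookup-index i∈) Aᵢx
        where i∈ = ∈met (x , Sx , Aᵢx)

  indivisible-meets-one-part : ∀ {S} → Indivisible Δ S → (∀ x → S x → ∃ λ i → A i x)
                             → ∀ {i j} → i ≢ j → Meets S i → Meets S j → ⊥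
  indivisible-meets-one-part {S} indiv covered i≢j meetsᵢ meetsⱼ =
    ¬¬-decidable k (Meets S) λ meets? →
      indiv (restriction-divides meets? covered i≢j meetsᵢ meetsⱼ)

lemma3 : (Δ₂ : ℕ) → 1 ≤ Δ₂ → (S₁ S₂ : TESet)
       → WellFormedSet S₁ → WellFormedSet S₂ → Finite S₁ → Finite S₂
       → Indivisible Δ₂ S₁ → Indivisible Δ₂ S₂
       → Satisfiable (S₁ ∩ S₂)
       → Indivisible Δ₂ (S₁ ∪ S₂)
lemma3 Δ₂ _ S₁ S₂ _ _ _ _ indiv₁ indiv₂ (x , S₁x , S₂x) (k , 2≤k , A , nonempty , indep , cover)
  with proj₁ (cover x) (inj₁ S₁x)
... | i , Aᵢx with ∃-≢ 2≤k i
... | j , i≢j with nonempty j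
... | z , Aⱼz with proj₂ (cover z) (j , Aⱼz)
... | inj₁ S₁z = indivisible-meets-one-part indep indiv₁ (λ y → proj₁ (cover y) ∘ inj₁)
                   i≢j (x , S₁x , Aᵢx) (z , S₁z , Aⱼz)
... | inj₂ S₂z = indivisible-meets-one-part indep indiv₂ (λ y → proj₁ (cover y) ∘ inj₂)
                   i≢j (x , S₂x , Aᵢx) (z , S₂z , Aⱼz)
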